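{- Let $n > k \ge 2$ be integers with $k$ known to the algorithm. The minimum number of queries that a non-adaptive algorithm must make to an error-free same-cluster oracle in order to learn every partition of $V=[n]$ into exactly $k$ nonempty clusters is: (i) $n-1$ if $k=2$; (ii) $5$ if $k=3$ and $n=4$; (iii) $\binom{n}{2} - \lfloor n/2 \rfloor$ if $k=3$ and $n\ge 5$; (iv) $\binom{n}{2}-1$ if $k\ge 4$.
   Context: Given a partition $\mathcal{C}$ of a finite set $V$, the (error-free) same-cluster oracle takes a pair $\{u,v\}$ of distinct elements of $V$ and answers whether $u$ and $v$ lie in the same cluster of $\mathcal{C}$. A non-adaptive algorithm submits all its queries in a single round (chosen before seeing any answers) and then must determine $\mathcal{C}$ exactly from the answers, for every partition $\mathcal{C}$ of $V$ into exactly $k$ nonempty clusters. -}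

module Defs where

open import Data.Nat using (ℕ; _≤_)
open import Data.Fin using (Fin) renaming (_<_ to _<ᶠ_)
open import Data.Product using (_×_; ∃; proj₁; proj₂)
open import Data.List using (List; length)
open import Data.List.Relation.Unary.All using (All)
open import Data.List.Relation.Unary.Unique.Propositional using (Unique)
open import Data.List.Membership.Propositional using (_∈_)
open import Relation.Binary.PropositionalEquality using (_≡_)
open import Function.Bundles using (_⇔_)

-- A partition of V = Fin n into exactly k nonempty clusters is represented by a
-- labelling c : Fin n → Fin k that is surjective (every label/cluster nonempty).
-- Two labellings represent the same partition iff they induce the same
-- same-cluster relation.
Labelling : ℕ → ℕ → Set
Labelling n k = Fin n → Fin k

AllClustersNonempty : ∀ {n k} → Labelling n k → Set
AllClustersNonempty {n} {k} c = (j : Fin k) → ∃ λ (i : Fin n) → c i ≡ j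

SameCluster : ∀ {n k} → Labelling n k → Fin n → Fin n → Set
SameCluster c u v = c u ≡ c v

SamePartition : ∀ {n k} → Labelling n k → Labelling n k → Set
SamePartition {n} c c' = (u v : Fin n) → SameCluster c u v ⇔ SameCluster c' u v

-- A non-adaptive query set: a set of unordered pairs {u,v} of distinct elements,
-- each pair written once as (u , v) with u < v, without repetitions.
Query : ℕ → Set
Query n = Fin n × Fin n

ValidQuerySet : ∀ {n} → List (Query n) → Set
ValidQuerySet Q = All (λ q → proj₁ q <ᶠ proj₂ q) Q × Unique Q

SameAnswers : ∀ {n k} → List (Query n) → Labelling n k → Labelling n k → Set
SameAnswers Q c c' =
  ∀ {q} → q ∈ Q → SameCluster c (proj₁ q) (proj₂ q) ⇔ SameCluster c' (proj₁ q) (proj₂ q)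

Learns : (n k : ℕ) → List (Query n) → Set
Learns n k Q =
  (c c' : Labelling n k) → AllClustersNonempty c → AllClustersNonempty c' →
  SameAnswers Q c c' → SamePartition c c'

MinQueries : (n k m : ℕ) → Set
MinQueries n k m =
  (∃ λ (Q : List (Query n)) → ValidQuerySet Q × Learns n k Q × length Q ≡ m)
  × ((Q : List (Query n)) → ValidQuerySet Q → Learns n k Q → m ≤ length Q)

-- For k = 2 the star at vertex 0 suffices: with two labels, whether u and v
-- share a cluster is decided by comparing both with vertex 0.  For k ≥ 3 it suffices to ask
-- every pair except one, or (k = 3, n ≥ 5) except a perfect matching: if two labellings
-- disagreed on an unasked pair {u, v}, the answers on the asked pairs would force the other
-- vertices into more clusters than the labels left over.
--
-- For k = 2 count: the 2^(n-2) partitions separating 0 from 1, together with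
-- {0, 1} against the rest, need pairwise different answer words in {0,1}^|Q|.  For k ≥ 3,
-- two unasked pairs {x, y}, {x, z} sharing a vertex cannot be resolved: moving x from the
-- cluster {x, y} to the singleton {z} changes only these two answers.  So the unasked pairs
-- form a matching, of size at most ⌊n/2⌋.  If moreover k ≥ 4 or n = 4, two disjoint unasked
-- pairs {x, y}, {z, t} cannot be resolved either ({x, y}, {z}, {t} against {x}, {y}, {z, t}),
-- so at most one pair is unasked.
module Submission where

open import Defs
open import Data.Bool using (Bool; true; false)
open import Data.Empty using (⊥; ⊥-elim)
open import Data.Fin using (Fin; zero; suc; toℕ; _≟_; inject≤; punchIn; punchOut) renaming (_<_ to _<ᶠ_)
import Data.Fin.Properties as Fin
open import Data.Fin.Patterns using (0F; 1F; 2F; 3F)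
open import Data.Fin.Permutation
  using (Permutation′; _⟨$⟩ʳ_; _⟨$⟩ˡ_; inverseʳ; inverseˡ; transpose; _∘ₚ_; id)
open import Data.List using (List; []; _∷_; _++_; map; length; filter; allFin)
import Data.List.Properties as List
open import Data.List.Membership.Propositional using (_∈_; _∉_)
open import Data.List.Membership.Propositional.Properties
  using (∈-∃++; ∈-++⁺ˡ; ∈-++⁺ʳ; ∈-map⁺; ∈-map⁻; ∈-allFin; ∈-filter⁺; ∈-filter⁻)
import Data.List.Membership.DecPropositional as DecMembership
open import Data.List.Relation.Binary.Subset.Propositional using (_⊆_)
open import Data.List.Relation.Unary.All using (All; []; _∷_)
import Data.List.Relation.Unary.All as All
import Data.List.Relation.Unary.All.Properties as All
open import Data.List.Relation.Unary.AllPairs using (AllPairs)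
import Data.List.Relation.Unary.AllPairs as AllPairs
import Data.List.Relation.Unary.AllPairs.Properties as AllPairs
open import Data.List.Relation.Unary.Any using (here; there)
open import Data.List.Relation.Unary.Unique.Propositional using (Unique; []; _∷_)
import Data.List.Relation.Unary.Unique.Propositional.Properties as Unique
open import Data.Nat using (ℕ; zero; suc; _≤_; _<_; _+_; _*_; _∸_; _^_; _/_; z≤n; s≤s)
open import Data.Nat.Combinatorics using (_C_; nC1≡n; nCk+nC[k+1]≡[n+1]C[k+1])
import Data.Nat.DivMod as ℕ
import Data.Nat.Properties as ℕ
open import Data.Product using (_×_; _,_; proj₁; proj₂; ∃; ∃₂)
open import Data.Product.Properties using (≡-dec)
import Data.Sum
open import Data.Sum using (_⊎_; inj₁; inj₂; [_,_])
open import Data.Vec.Functional using (Vector) renaming (_∷_ to _◂_)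
open import Function using (_∘_)
open import Function.Bundles using (_⇔_; mk⇔; Equivalence)
open import Relation.Binary using (tri<; tri≈; tri>)
open import Relation.Binary.PropositionalEquality
  using (_≡_; _≢_; refl; sym; trans; cong; cong₂; subst; subst₂; module ≡-Reasoning)
open import Relation.Nullary using (¬_; Dec; yes; no; ¬?; does)
open import Relation.Nullary.Decidable using (decidable-stable; _⊎-dec_)
open import Relation.Unary using (Decidable)

unique-⊆⇒length≤ : ∀ {A : Set} {xs ys : List A} → Unique xs → xs ⊆ ys → length xs ≤ length ys
unique-⊆⇒length≤ {xs = []}     []           _     = z≤n
unique-⊆⇒length≤ {xs = x ∷ xs} (x∉xs ∷ uxs) xs⊆ys with as , bs , refl ← ∈-∃++ (xs⊆ys (here refl)) =
  subst (suc (length xs) ≤_) (sym (length-insert as bs))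
    (s≤s (unique-⊆⇒length≤ uxs λ y∈ → ∈-remove as bs (xs⊆ys (there y∈)) (λ y≡x → All.lookup x∉xs y∈ (sym y≡x))))
  where
  length-insert : ∀ as bs → length (as ++ x ∷ bs) ≡ suc (length (as ++ bs))
  length-insert []       bs = refl
  length-insert (a ∷ as) bs = cong suc (length-insert as bs)
  ∈-remove : ∀ {y} as bs → y ∈ as ++ x ∷ bs → y ≢ x → y ∈ as ++ bs
  ∈-remove []       bs (here refl) y≢x = ⊥-elim (y≢x refl)
  ∈-remove []       bs (there y∈)  y≢x = y∈
  ∈-remove (a ∷ as) bs (here refl) y≢x = here refl
  ∈-remove (a ∷ as) bs (there y∈)  y≢x = there (∈-remove as bs y∈ y≢x)

length-filter+∁ : ∀ {A : Set} {P : A → Set} (P? : Decidable P) xs →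
                  length (filter P? xs) + length (filter (¬? ∘ P?) xs) ≡ length xs
length-filter+∁ P? []       = refl
length-filter+∁ P? (x ∷ xs) with P? x
... | yes _ = cong suc (length-filter+∁ P? xs)
... | no  _ = trans (ℕ.+-suc _ _) (cong suc (length-filter+∁ P? xs))

at-most-one : ∀ {A : Set} {xs : List A} → Unique xs → (∀ {x y} → x ∈ xs → y ∈ xs → x ≡ y) → length xs ≤ 1
at-most-one []              _     = z≤n
at-most-one (_ ∷ [])        _     = s≤s z≤n
at-most-one ((x≢y ∷ _) ∷ _) equal = ⊥-elim (x≢y (equal (here refl) (there (here refl))))

map-≡⇒≡ : ∀ {A B : Set} {f g : A → B} {xs} → map f xs ≡ map g xs → ∀ {x} → x ∈ xs → f x ≡ g x
map-≡⇒≡ {xs = _ ∷ _} e (here refl) = proj₁ (List.∷-injective e)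
map-≡⇒≡ {xs = _ ∷ _} e (there x∈)  = map-≡⇒≡ (proj₂ (List.∷-injective e)) x∈

∃∉ : ∀ {n} (vs : List (Fin n)) → length vs < n → ∃ λ z → z ∉ vs
∃∉ {n} vs |vs|<n with Fin.any? (λ z → ¬? (DecMembership._∈?_ _≟_ z vs))
... | yes found = found
... | no  none  = ⊥-elim (ℕ.<⇒≱ |vs|<n
    (subst (_≤ length vs) (List.length-tabulate {n = n} (λ i → i))
      (unique-⊆⇒length≤ (Unique.allFin⁺ n)
        λ {z} _ → decidable-stable (DecMembership._∈?_ _≟_ z vs) (λ z∉ → none (z , z∉)))))

≢-unique₂ : ∀ {z a b : Fin 2} → a ≢ z → b ≢ z → a ≡ b
≢-unique₂ {0F} {0F}      a≢z _   = ⊥-elim (a≢z refl)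
≢-unique₂ {0F} {1F} {0F} _   b≢z = ⊥-elim (b≢z refl)
≢-unique₂ {0F} {1F} {1F} _   _   = refl
≢-unique₂ {1F} {0F} {0F} _   _   = refl
≢-unique₂ {1F} {0F} {1F} _   b≢z = ⊥-elim (b≢z refl)
≢-unique₂ {1F} {1F}      a≢z _   = ⊥-elim (a≢z refl)

≢-unique₃ : ∀ {x y a b : Fin 3} → x ≢ y → a ≢ x → a ≢ y → b ≢ x → b ≢ y → a ≡ b
≢-unique₃ x≢y a≢x a≢y b≢x b≢y =
  Fin.punchOut-injective (a≢x ∘ sym) (b≢x ∘ sym)
    (≢-unique₂ (a≢y ∘ Fin.punchOut-injective _ x≢y) (b≢y ∘ Fin.punchOut-injective _ x≢y))

≡-determined₂ : ∀ {z x y : Fin 2} → (z ≡ x → z ≡ y) → (z ≡ y → z ≡ x) → x ≡ y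
≡-determined₂ {z} {x} to from with z ≟ x
... | yes z≡x = trans (sym z≡x) (to z≡x)
... | no  z≢x = ≢-unique₂ (z≢x ∘ sym) (z≢x ∘ from ∘ sym)

pigeonhole-avoiding : ∀ {j} {a b : Fin (suc (suc j))} → a ≢ b →
  (f : Fin (suc j) → Fin (suc (suc j))) → (∀ i → f i ≢ a) → (∀ i → f i ≢ b) →
  ∃₂ λ i i′ → i <ᶠ i′ × f i ≡ f i′
pigeonhole-avoiding {j} a≢b f f≢a f≢b = unsqueeze (Fin.pigeonhole (ℕ.n<1+n j) squeezed)
  where
  g : Fin (suc j) → Fin (suc j)
  g i = punchOut (f≢a i ∘ sym)
  g≢b′ : ∀ i → g i ≢ punchOut a≢b
  g≢b′ i = f≢b i ∘ Fin.punchOut-injective _ a≢b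
  squeezed : Fin (suc j) → Fin j
  squeezed i = punchOut (g≢b′ i ∘ sym)
  unsqueeze : (∃₂ λ i i′ → i <ᶠ i′ × squeezed i ≡ squeezed i′) → ∃₂ λ i i′ → i <ᶠ i′ × f i ≡ f i′
  unsqueeze (i , i′ , i<i′ , eq) =
    i , i′ , i<i′ , Fin.punchOut-injective (f≢a i ∘ sym) (f≢a i′ ∘ sym)
                      (Fin.punchOut-injective (g≢b′ i ∘ sym) (g≢b′ i′ ∘ sym) eq)

exponent-< : ∀ {a b} → 2 ^ a < 2 ^ b → a < b
exponent-< {a} {b} 2^a<2^b with a ℕ.<? b
... | yes a<b = a<b
... | no  a≮b = ⊥-elim (ℕ.<⇒≱ 2^a<2^b (ℕ.^-monoʳ-≤ 2 (ℕ.≮⇒≥ a≮b)))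

swap⇔ : ∀ {A B : Set} {a b : A} {c d : B} → (a ≡ b ⇔ c ≡ d) → (b ≡ a ⇔ d ≡ c)
swap⇔ a≡b⇔c≡d = mk⇔ (sym ∘ Equivalence.to a≡b⇔c≡d ∘ sym) (sym ∘ Equivalence.from a≡b⇔c≡d ∘ sym)

does-≡⇒⇔ : ∀ {P P′ : Set} (d : Dec P) (d′ : Dec P′) → does d ≡ does d′ → P ⇔ P′
does-≡⇒⇔ (yes p) (yes p′) _ = mk⇔ (λ _ → p′) (λ _ → p)
does-≡⇒⇔ (no ¬p) (no ¬p′) _ = mk⇔ (⊥-elim ∘ ¬p) (⊥-elim ∘ ¬p′)

Ordered : ∀ {n} → Query n → Set
Ordered q = proj₁ q <ᶠ proj₂ q

liftPair : ∀ {n} → Query n → Query (suc n)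
liftPair (u , v) = suc u , suc v

liftPair-injective : ∀ {n} {p q : Query n} → liftPair p ≡ liftPair q → p ≡ q
liftPair-injective refl = refl

star : ∀ n → List (Query (suc n))
star n = map (λ i → zero , suc i) (allFin n)

length-star : ∀ n → length (star n) ≡ n
length-star n = trans (List.length-map _ (allFin n)) (List.length-tabulate {n = n} (λ i → i))

star-ordered : ∀ n → All Ordered (star n)
star-ordered n = All.map⁺ (All.universal (λ _ → s≤s z≤n) (allFin n))

star-unique : ∀ n → Unique (star n)
star-unique n = Unique.map⁺ (λ eq → Fin.suc-injective (cong proj₂ eq)) (Unique.allFin⁺ n)

allPairs : ∀ n → List (Query n)
allPairs zero    = []
allPairs (suc n) = star n ++ map liftPair (allPairs n)

length-allPairs : ∀ n → length (allPairs n) ≡ n C 2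
length-allPairs zero    = refl
length-allPairs (suc n) = begin
  length (star n ++ map liftPair (allPairs n))         ≡⟨ List.length-++ (star n) ⟩
  length (star n) + length (map liftPair (allPairs n)) ≡⟨ cong₂ _+_ (length-star n)
                                                            (trans (List.length-map liftPair (allPairs n)) (length-allPairs n)) ⟩
  n + n C 2                                            ≡⟨ cong (_+ n C 2) (nC1≡n n) ⟨
  n C 1 + n C 2                                        ≡⟨ nCk+nC[k+1]≡[n+1]C[k+1] n 1 ⟩
  suc n C 2                                            ∎
  where open ≡-Reasoning

allPairs-ordered : ∀ n → All Ordered (allPairs n)
allPairs-ordered zero    = []
allPairs-ordered (suc n) = All.++⁺ (star-ordered n) (All.map⁺ (All.map s≤s (allPairs-ordered n)))

allPairs-unique : ∀ n → Unique (allPairs n)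
allPairs-unique zero    = []
allPairs-unique (suc n) =
  Unique.++⁺ (star-unique n) (Unique.map⁺ liftPair-injective (allPairs-unique n)) star∩lifted
  where
  star∩lifted : ∀ {p} → ¬ (p ∈ star n × p ∈ map liftPair (allPairs n))
  star∩lifted (p∈star , p∈lifted) with ∈-map⁻ _ p∈star | ∈-map⁻ liftPair p∈lifted
  ... | _ , _ , refl | _ , _ , ()

∈-allPairs : ∀ {n} {u v : Fin n} → u <ᶠ v → (u , v) ∈ allPairs n
∈-allPairs {suc n} {zero}  {suc v} _         = ∈-++⁺ˡ (∈-map⁺ _ (∈-allFin v))
∈-allPairs {suc n} {suc u} {suc v} (s≤s u<v) = ∈-++⁺ʳ (star n) (∈-map⁺ liftPair (∈-allPairs u<v))

_∈?_ : ∀ {n} (p : Query n) (Q : List (Query n)) → Dec (p ∈ Q)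
_∈?_ = DecMembership._∈?_ (≡-dec _≟_ _≟_)

Joins : ∀ {n} → List (Query n) → Fin n → Fin n → Set
Joins Q u v = (u , v) ∈ Q ⊎ (v , u) ∈ Q

joins-sym : ∀ {n} {Q : List (Query n)} {u v} → Joins Q u v → Joins Q v u
joins-sym (inj₁ uv∈) = inj₂ uv∈
joins-sym (inj₂ vu∈) = inj₁ vu∈

joins? : ∀ {n} (Q : List (Query n)) u v → Dec (Joins Q u v)
joins? Q u v = (u , v) ∈? Q ⊎-dec (v , u) ∈? Q

joins-ordered⇒≢ : ∀ {n} {E : List (Query n)} → All Ordered E → ∀ {a b} → Joins E a b → a ≢ b
joins-ordered⇒≢ ordered (inj₁ ab∈) = Fin.<⇒≢ (All.lookup ordered ab∈)
joins-ordered⇒≢ ordered (inj₂ ba∈) = Fin.<⇒≢ (All.lookup ordered ba∈) ∘ sym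

complement : ∀ {n} → List (Query n) → List (Query n)
complement {n} E = filter (λ p → ¬? (p ∈? E)) (allPairs n)

complement-ordered : ∀ {n} (E : List (Query n)) → All Ordered (complement E)
complement-ordered {n} E = All.filter⁺ (λ p → ¬? (p ∈? E)) (allPairs-ordered n)

complement-unique : ∀ {n} (E : List (Query n)) → Unique (complement E)
complement-unique {n} E = Unique.filter⁺ (λ p → ¬? (p ∈? E)) (allPairs-unique n)

∈-complement⁻ : ∀ {n} {E : List (Query n)} {p} → p ∈ complement E → p ∉ E
∈-complement⁻ {n} {E} p∈ = proj₂ (∈-filter⁻ (λ p → ¬? (p ∈? E)) {xs = allPairs n} p∈)

joins-complement : ∀ {n} {E : List (Query n)} {u v} → u ≢ v → ¬ Joins E u v → Joins (complement E) u v
joins-complement {E = E} {u} {v} u≢v ¬uv with Fin.<-cmp u v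
... | tri< u<v _ _ = inj₁ (∈-filter⁺ (λ p → ¬? (p ∈? E)) (∈-allPairs u<v) (¬uv ∘ inj₁))
... | tri≈ _ u≡v _ = ⊥-elim (u≢v u≡v)
... | tri> _ _ v<u = inj₂ (∈-filter⁺ (λ p → ¬? (p ∈? E)) (∈-allPairs v<u) (¬uv ∘ inj₂))

complement-unasked : ∀ {n} {Q : List (Query n)} → All Ordered Q → ∀ {a b} → Joins (complement Q) a b → ¬ Joins Q a b
complement-unasked {Q = Q} ordered = unasked
  where
  opposite : ∀ {p q} → p ∈ complement Q → q ∈ Q → proj₁ p ≡ proj₂ q → proj₂ p ≡ proj₁ q → ⊥
  opposite p∈ q∈ refl refl = Fin.<-asym (All.lookup (complement-ordered Q) p∈) (All.lookup ordered q∈)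
  unasked : ∀ {a b} → Joins (complement Q) a b → ¬ Joins Q a b
  unasked (inj₁ ab∈) (inj₁ ab∈Q) = ∈-complement⁻ ab∈ ab∈Q
  unasked (inj₁ ab∈) (inj₂ ba∈Q) = opposite ab∈ ba∈Q refl refl
  unasked (inj₂ ba∈) (inj₁ ab∈Q) = opposite ba∈ ab∈Q refl refl
  unasked (inj₂ ba∈) (inj₂ ba∈Q) = ∈-complement⁻ ba∈ ba∈Q

module _ {n : ℕ} (E : List (Query n)) where

  private
    inside : List (Query n)
    inside = filter (_∈? E) (allPairs n)

    inside+complement : length inside + length (complement E) ≡ n C 2
    inside+complement = trans (length-filter+∁ (_∈? E) (allPairs n)) (length-allPairs n)

    inside≤E : length inside ≤ length E
    inside≤E = unique-⊆⇒length≤ (Unique.filter⁺ (_∈? E) (allPairs-unique n))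
                 (λ p∈ → proj₂ (∈-filter⁻ (_∈? E) {xs = allPairs n} p∈))

  complement-covers : n C 2 ≤ length (complement E) + length E
  complement-covers = subst (_≤ length (complement E) + length E)
    (trans (ℕ.+-comm (length (complement E)) (length inside)) inside+complement)
    (ℕ.+-monoʳ-≤ (length (complement E)) inside≤E)

  length-complement : All Ordered E → Unique E → length (complement E) ≡ n C 2 ∸ length E
  length-complement ordered unique = begin
    length (complement E)                            ≡⟨ ℕ.m+n∸n≡m (length (complement E)) (length E) ⟨
    length (complement E) + length E ∸ length E      ≡⟨ cong (λ e → length (complement E) + e ∸ length E)
                                                          (ℕ.≤-antisym E≤inside inside≤E) ⟩
    length (complement E) + length inside ∸ length E ≡⟨ cong (_∸ length E)
                                                          (trans (ℕ.+-comm (length (complement E)) (length inside))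
                                                                 inside+complement) ⟩
    n C 2 ∸ length E                                 ∎
    where
    open ≡-Reasoning
    E≤inside : length E ≤ length inside
    E≤inside = unique-⊆⇒length≤ unique λ p∈ → ∈-filter⁺ (_∈? E) (∈-allPairs (All.lookup ordered p∈)) p∈

complement≤⇒length≥ : ∀ {n g} (Q : List (Query n)) → length (complement Q) ≤ g → n C 2 ∸ g ≤ length Q
complement≤⇒length≥ {n} {g} Q few =
  ℕ.m≤n+o⇒m∸n≤o (n C 2) g (ℕ.≤-trans (complement-covers Q) (ℕ.+-monoˡ-≤ (length Q) few))

-- Matchings

IsMatching : ∀ {n} → List (Query n) → Set
IsMatching E = ∀ {a b b′} → Joins E a b → Joins E a b′ → b ≡ b′

isMatching-∷⁻ : ∀ {n} {p} {E : List (Query n)} → IsMatching (p ∷ E) → IsMatching E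
isMatching-∷⁻ matching j j′ = matching (weaken j) (weaken j′)
  where
  weaken : ∀ {a b} → Joins _ a b → Joins (_ ∷ _) a b
  weaken (inj₁ ab∈) = inj₁ (there ab∈)
  weaken (inj₂ ba∈) = inj₂ (there ba∈)

matching-disjoint : ∀ {n} {E : List (Query n)} → All Ordered E → IsMatching E →
                    ∀ {a b c d} → (a , b) ∈ E → (c , d) ∈ E → (a , b) ≢ (c , d) →
                    (a ≢ c × a ≢ d) × (b ≢ c × b ≢ d)
matching-disjoint {E = E} ordered matching ab∈ cd∈ ab≢cd =
  ( (λ { refl → ab≢cd (cong (_ ,_) (matching (inj₁ ab∈) (inj₁ cd∈))) })
  , (λ { refl → crossed ab∈ cd∈ (matching (inj₁ ab∈) (inj₂ cd∈)) }) )
  , ( (λ { refl → crossed cd∈ ab∈ (sym (matching (inj₂ ab∈) (inj₁ cd∈))) })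
  , (λ { refl → ab≢cd (cong (_, _) (matching (inj₂ ab∈) (inj₂ cd∈))) }) )
  where
  crossed : ∀ {a b c} → (a , b) ∈ E → (c , a) ∈ E → b ≢ c
  crossed ab∈ ba∈ refl = Fin.<-asym (All.lookup ordered ab∈) (All.lookup ordered ba∈)

endpoints : ∀ {n} → List (Query n) → List (Fin n)
endpoints []             = []
endpoints ((a , b) ∷ ps) = a ∷ b ∷ endpoints ps

length-endpoints : ∀ {n} (ps : List (Query n)) → length (endpoints ps) ≡ length ps + length ps
length-endpoints []       = refl
length-endpoints (_ ∷ ps) =
  cong suc (trans (cong suc (length-endpoints ps)) (sym (ℕ.+-suc (length ps) (length ps))))

∈-endpoints⁻ : ∀ {n} {v : Fin n} ps → v ∈ endpoints ps → ∃ λ p → p ∈ ps × (proj₁ p ≡ v ⊎ proj₂ p ≡ v)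
∈-endpoints⁻ ((a , b) ∷ ps) (here refl)         = (a , b) , here refl , inj₁ refl
∈-endpoints⁻ ((a , b) ∷ ps) (there (here refl)) = (a , b) , here refl , inj₂ refl
∈-endpoints⁻ (_       ∷ ps) (there (there v∈))  with p , p∈ , end ← ∈-endpoints⁻ ps v∈ = p , there p∈ , end

endpoints-unique : ∀ {n} {E : List (Query n)} → All Ordered E → Unique E → IsMatching E → Unique (endpoints E)
endpoints-unique {E = []}            []                    []                _        = []
endpoints-unique {E = (a , b) ∷ ps} ordered@(a<b ∷ ordps) (ab∉ps ∷ uniqps) matching =
  (Fin.<⇒≢ a<b ∷ All.tabulate (proj₁ ∘ apart)) ∷ All.tabulate (proj₂ ∘ apart)
  ∷ endpoints-unique ordps uniqps (isMatching-∷⁻ matching)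
  where
  apart : ∀ {v} → v ∈ endpoints ps → a ≢ v × b ≢ v
  apart v∈ with p , p∈ , end ← ∈-endpoints⁻ ps v∈ =
    from-disjoint (matching-disjoint ordered matching (here refl) (there p∈) (All.lookup ab∉ps p∈)) end
    where
    from-disjoint : ∀ {c d v} → (a ≢ c × a ≢ d) × (b ≢ c × b ≢ d) → c ≡ v ⊎ d ≡ v → a ≢ v × b ≢ v
    from-disjoint ((a≢c , _) , (b≢c , _)) (inj₁ refl) = a≢c , b≢c
    from-disjoint ((_ , a≢d) , (_ , b≢d)) (inj₂ refl) = a≢d , b≢d

matching-length : ∀ {n} {E : List (Query n)} → All Ordered E → Unique E → IsMatching E → length E ≤ n / 2
matching-length {n} {E} ordered unique matching =
  subst (_≤ n / 2) (ℕ.m*n/n≡m (length E) 2) (ℕ./-monoˡ-≤ 2 (subst (_≤ n) twice count))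
  where
  count : length E + length E ≤ n
  count = subst₂ _≤_ (length-endpoints E) (List.length-tabulate {n = n} (λ i → i))
    (unique-⊆⇒length≤ (endpoints-unique ordered unique matching) (λ {v} _ → ∈-allFin v))
  twice : length E + length E ≡ length E * 2
  twice = trans (cong (length E +_) (sym (ℕ.+-identityʳ (length E)))) (ℕ.*-comm 2 (length E))

partner : ℕ → ℕ
partner zero          = 1
partner (suc zero)    = 0
partner (suc (suc a)) = suc (suc (partner a))

partner-involutive : ∀ a → partner (partner a) ≡ a
partner-involutive zero          = refl
partner-involutive (suc zero)    = refl
partner-involutive (suc (suc a)) = cong (λ b → suc (suc b)) (partner-involutive a)

perfectMatching : ∀ n → List (Query n)
perfectMatching (suc (suc m)) = (0F , 1F) ∷ map (liftPair ∘ liftPair) (perfectMatching m)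
perfectMatching _             = []

∈-perfectMatching : ∀ {n a b} → (a , b) ∈ perfectMatching n → toℕ b ≡ partner (toℕ a)
∈-perfectMatching {suc (suc _)} (here refl) = refl
∈-perfectMatching {suc (suc _)} (there ab∈) with _ , ab∈′ , refl ← ∈-map⁻ (liftPair ∘ liftPair) ab∈ =
  cong (λ b → suc (suc b)) (∈-perfectMatching ab∈′)

perfectMatching-isMatching : ∀ {n} → IsMatching (perfectMatching n)
perfectMatching-isMatching {n} j j′ = Fin.toℕ-injective (trans (partnerOf j) (sym (partnerOf j′)))
  where
  partnerOf : ∀ {a b} → Joins (perfectMatching n) a b → toℕ b ≡ partner (toℕ a)
  partnerOf (inj₁ ab∈) = ∈-perfectMatching ab∈
  partnerOf {b = b} (inj₂ ba∈) =
    trans (sym (partner-involutive (toℕ b))) (cong partner (sym (∈-perfectMatching ba∈)))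

perfectMatching-ordered : ∀ n → All Ordered (perfectMatching n)
perfectMatching-ordered zero          = []
perfectMatching-ordered (suc zero)    = []
perfectMatching-ordered (suc (suc m)) =
  s≤s z≤n ∷ All.map⁺ (All.map (s≤s ∘ s≤s) (perfectMatching-ordered m))

perfectMatching-unique : ∀ n → Unique (perfectMatching n)
perfectMatching-unique zero          = []
perfectMatching-unique (suc zero)    = []
perfectMatching-unique (suc (suc m)) =
  All.map⁺ (All.universal (λ { (a , b) () }) (perfectMatching m))
  ∷ Unique.map⁺ (liftPair-injective ∘ liftPair-injective) (perfectMatching-unique m)

length-perfectMatching : ∀ n → length (perfectMatching n) ≡ n / 2
length-perfectMatching zero          = refl
length-perfectMatching (suc zero)    = refl
length-perfectMatching (suc (suc m)) =
  trans (cong suc (trans (List.length-map (liftPair ∘ liftPair) (perfectMatching m)) (length-perfectMatching m)))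
        (sym (ℕ.m/n≡1+[m∸n]/n {suc (suc m)} {2} (s≤s (s≤s z≤n))))

sameAnswers-sym : ∀ {n k} {Q : List (Query n)} {c c′ : Labelling n k} →
                  SameAnswers Q c c′ → SameAnswers Q c′ c
sameAnswers-sym same q∈ = mk⇔ (Equivalence.from (same q∈)) (Equivalence.to (same q∈))

sameAnswers-trans : ∀ {n k} {Q : List (Query n)} {c c′ c″ : Labelling n k} →
                    SameAnswers Q c c′ → SameAnswers Q c′ c″ → SameAnswers Q c c″
sameAnswers-trans same same′ q∈ =
  mk⇔ (Equivalence.to (same′ q∈) ∘ Equivalence.to (same q∈)) (Equivalence.from (same q∈) ∘ Equivalence.from (same′ q∈))

joins⇒agree : ∀ {n k} {Q : List (Query n)} {c c′ : Labelling n k} → SameAnswers Q c c′ →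
              ∀ {u v} → Joins Q u v → SameCluster c u v ⇔ SameCluster c′ u v
joins⇒agree same (inj₁ uv∈) = same uv∈
joins⇒agree same (inj₂ vu∈) = swap⇔ (same vu∈)

Preserves : ∀ {n} → ℕ → List (Query n) → Set
Preserves {n} k Q = ∀ {c c′ : Labelling n k} → AllClustersNonempty c → SameAnswers Q c c′ →
                    ∀ {u v} → SameCluster c u v → SameCluster c′ u v

preserves⇒learns : ∀ {n k} {Q : List (Query n)} → Preserves k Q → Learns n k Q
preserves⇒learns preserves c c′ sc sc′ same u v =
  mk⇔ (preserves sc same) (preserves sc′ (sameAnswers-sym same))

confusable⇒¬learns : ∀ {n k} {Q : List (Query n)} {c c′ : Labelling n k} →
  AllClustersNonempty c → AllClustersNonempty c′ → SameAnswers Q c c′ →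
  ∀ {x y} → SameCluster c x y → ¬ SameCluster c′ x y → ¬ Learns n k Q
confusable⇒¬learns sc sc′ same cx≡cy c′x≢c′y learns =
  c′x≢c′y (Equivalence.to (learns _ _ sc sc′ same _ _) cx≡cy)

-- Upper bounds

star-learns : ∀ m → Learns (suc m) 2 (star m)
star-learns m = preserves⇒learns preserve
  where
  preserve : Preserves 2 (star m)
  preserve {c} {c′} _ same {u} {v} cu≡cv =
    ≡-determined₂ (λ e → to (viaRoot v) (trans (from (viaRoot u) e) cu≡cv))
                  (λ e → to (viaRoot u) (trans (from (viaRoot v) e) (sym cu≡cv)))
    where
    open Equivalence
    viaRoot : ∀ w → SameCluster c 0F w ⇔ SameCluster c′ 0F w
    viaRoot zero    = mk⇔ (λ _ → refl) (λ _ → refl)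
    viaRoot (suc i) = same (∈-map⁺ _ (∈-allFin i))

GapsPreserved : ∀ {n} → ℕ → List (Query n) → Set
GapsPreserved {n} k E = ∀ {c c′ : Labelling n k} → AllClustersNonempty c → SameAnswers (complement E) c c′ →
                        ∀ {u v} → Joins E u v → SameCluster c u v → SameCluster c′ u v

learns-complement : ∀ {n k} (E : List (Query n)) → GapsPreserved k E → Learns n k (complement E)
learns-complement E across-gap = preserves⇒learns preserve
  where
  preserve : Preserves _ (complement E)
  preserve sc same {u} {v} cu≡cv with u ≟ v | joins? E u v
  ... | yes refl | _        = refl
  ... | no  u≢v  | yes gap  = across-gap sc same gap cu≡cv
  ... | no  u≢v  | no  ¬gap = Equivalence.to (joins⇒agree same (joins-complement u≢v ¬gap)) cu≡cv

-- Witnesses of the k − 1 labels other than c x would need distinct c′-labels avoiding c′ x ≠ c′ y.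
module _ {n j} {Q : List (Query n)} {c c′ : Labelling n (suc (suc j))}
         (sc : AllClustersNonempty c) (same : SameAnswers Q c c′) {x y : Fin n}
         (asked : ∀ {a w} → a ≢ w → w ≢ x → w ≢ y → Joins Q a w) where

  lone-gap-preserved : SameCluster c x y → SameCluster c′ x y
  lone-gap-preserved cx≡cy with c′ x ≟ c′ y
  ... | yes c′x≡c′y = c′x≡c′y
  ... | no  c′x≢c′y =
    ⊥-elim (Fin.<⇒≢ i<i′ (Fin.punchIn-injective (c x) i i′ (trans (sym (labelled i)) (trans cw≡cw′ (labelled i′)))))
    where
    open Equivalence
    witness : Fin (suc j) → Fin n
    witness i = proj₁ (sc (punchIn (c x) i))
    labelled : ∀ i → c (witness i) ≡ punchIn (c x) i
    labelled i = proj₂ (sc (punchIn (c x) i))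
    c≢cx : ∀ i → c (witness i) ≢ c x
    c≢cx i = Fin.punchInᵢ≢i (c x) i ∘ trans (sym (labelled i))
    w≢x : ∀ i → witness i ≢ x
    w≢x i = c≢cx i ∘ cong c
    w≢y : ∀ i → witness i ≢ y
    w≢y i w≡y = c≢cx i (trans (cong c w≡y) (sym cx≡cy))
    c′≢c′x : ∀ i → c′ (witness i) ≢ c′ x
    c′≢c′x i e = c≢cx i (sym (from (joins⇒agree same (asked (w≢x i ∘ sym) (w≢x i) (w≢y i))) (sym e)))
    c′≢c′y : ∀ i → c′ (witness i) ≢ c′ y
    c′≢c′y i e =
      c≢cx i (trans (sym (from (joins⇒agree same (asked (w≢y i ∘ sym) (w≢x i) (w≢y i))) (sym e))) (sym cx≡cy))
    collision = pigeonhole-avoiding c′x≢c′y (c′ ∘ witness) c′≢c′x c′≢c′y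
    i  = proj₁ collision
    i′ = proj₁ (proj₂ collision)
    i<i′ = proj₁ (proj₂ (proj₂ collision))
    cw≡cw′ : c (witness i) ≡ c (witness i′)
    cw≡cw′ with witness i ≟ witness i′
    ... | yes w≡w′ = cong c w≡w′
    ... | no  w≢w′ = from (joins⇒agree same (asked w≢w′ (w≢x i′) (w≢y i′))) (proj₂ (proj₂ (proj₂ collision)))

-- All vertices outside {u, v} share one c′-label, so the two labels of c other than c u get
-- merged: directly when their witnesses are asked, through a fifth vertex when they are matched.
module _ {n} {E Q : List (Query n)} {c c′ : Labelling n 3} (n≥5 : 5 ≤ n) (matching : IsMatching E)
         (asked : ∀ {a b} → a ≢ b → ¬ Joins E a b → Joins Q a b)
         (sc : AllClustersNonempty c) (same : SameAnswers Q c c′) {u v : Fin n} (gap : Joins E u v) where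

  matched-gap-preserved : SameCluster c u v → SameCluster c′ u v
  matched-gap-preserved cu≡cv with c′ u ≟ c′ v
  ... | yes c′u≡c′v = c′u≡c′v
  ... | no  c′u≢c′v = ⊥-elim (merged (joins? E w₀ w₁))
    where
    open Equivalence
    Other : Fin n → Set
    Other w = w ≢ u × w ≢ v
    agree-u : ∀ {w} → Other w → SameCluster c u w ⇔ SameCluster c′ u w
    agree-u (w≢u , w≢v) = joins⇒agree same (asked (w≢u ∘ sym) (λ uw → w≢v (sym (matching gap uw))))
    agree-v : ∀ {w} → Other w → SameCluster c v w ⇔ SameCluster c′ v w
    agree-v (w≢u , w≢v) = joins⇒agree same (asked (w≢v ∘ sym) (λ vw → w≢u (sym (matching (joins-sym gap) vw))))
    c′≢c′u : ∀ {w} → Other w → c′ w ≢ c′ u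
    c′≢c′u o e = c′u≢c′v (trans (sym e) (sym (to (agree-v o) (trans (sym cu≡cv) (from (agree-u o) (sym e))))))
    c′≢c′v : ∀ {w} → Other w → c′ w ≢ c′ v
    c′≢c′v o e = c′u≢c′v (trans (to (agree-u o) (trans cu≡cv (from (agree-v o) (sym e)))) e)
    others-agree : ∀ {w w′} → Other w → Other w′ → ¬ Joins E w w′ → c w ≡ c w′
    others-agree {w} {w′} o o′ ¬j with w ≟ w′
    ... | yes w≡w′ = cong c w≡w′
    ... | no  w≢w′ = from (joins⇒agree same (asked w≢w′ ¬j))
                          (≢-unique₃ c′u≢c′v (c′≢c′u o) (c′≢c′v o) (c′≢c′u o′) (c′≢c′v o′))
    witness : Fin 2 → Fin n
    witness i = proj₁ (sc (punchIn (c u) i))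
    c≢cu : ∀ i → c (witness i) ≢ c u
    c≢cu i = Fin.punchInᵢ≢i (c u) i ∘ trans (sym (proj₂ (sc (punchIn (c u) i))))
    other : ∀ i → Other (witness i)
    other i = c≢cu i ∘ cong c , λ w≡v → c≢cu i (trans (cong c w≡v) (sym cu≡cv))
    w₀ = witness 0F
    w₁ = witness 1F
    cw₀≢cw₁ : c w₀ ≢ c w₁
    cw₀≢cw₁ e with Fin.punchIn-injective (c u) 0F 1F
                     (trans (sym (proj₂ (sc (punchIn (c u) 0F)))) (trans e (proj₂ (sc (punchIn (c u) 1F)))))
    ... | ()
    merged : Dec (Joins E w₀ w₁) → ⊥
    merged (no  ¬j) = cw₀≢cw₁ (others-agree (other 0F) (other 1F) ¬j)
    merged (yes j)  = cw₀≢cw₁ (trans (others-agree (other 0F) oz (λ j′ → z≢w₁ (sym (matching j j′))))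
                                     (sym (others-agree (other 1F) oz (λ j′ → z≢w₀ (sym (matching (joins-sym j) j′))))))
      where
      outside = ∃∉ (u ∷ v ∷ w₀ ∷ w₁ ∷ []) n≥5
      z = proj₁ outside
      oz : Other z
      oz = (λ e → proj₂ outside (here e)) , (λ e → proj₂ outside (there (here e)))
      z≢w₀ : z ≢ w₀
      z≢w₀ e = proj₂ outside (there (there (here e)))
      z≢w₁ : z ≢ w₁
      z≢w₁ e = proj₂ outside (there (there (there (here e))))

learns-all-but-one : ∀ {n j} (x y : Fin n) → Learns n (suc (suc j)) (complement ((x , y) ∷ []))
learns-all-but-one x y = learns-complement _ across
  where
  partners : ∀ {a w} → Joins ((x , y) ∷ []) a w → w ≡ x ⊎ w ≡ y
  partners (inj₁ (here refl)) = inj₂ refl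
  partners (inj₂ (here refl)) = inj₁ refl
  asked : ∀ {a w} → a ≢ w → w ≢ x → w ≢ y → Joins (complement ((x , y) ∷ [])) a w
  asked a≢w w≢x w≢y = joins-complement a≢w ([ w≢x , w≢y ] ∘ partners)
  across : GapsPreserved _ ((x , y) ∷ [])
  across sc same (inj₁ (here refl)) cu≡cv = lone-gap-preserved sc same asked cu≡cv
  across sc same (inj₂ (here refl)) cu≡cv = sym (lone-gap-preserved sc same asked (sym cu≡cv))

learns-all-but-matching : ∀ {n} {E : List (Query n)} → 5 ≤ n → IsMatching E → Learns n 3 (complement E)
learns-all-but-matching n≥5 matching =
  learns-complement _ λ sc same gap → matched-gap-preserved n≥5 matching joins-complement sc same gap

-- Indistinguishable partitions

Isolated : ∀ {n k} → Labelling n k → Fin n → Set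
Isolated c z = ∀ w → c w ≡ c z → w ≡ z

Paired : ∀ {n k} → Labelling n k → Fin n → Fin n → Set
Paired c x y = c x ≡ c y × (∀ w → c w ≡ c x → w ≡ x ⊎ w ≡ y)

module _ {n k} (c : Labelling n k) (x : Fin n) (ℓ : Fin k) where

  move : Labelling n k
  move w with w ≟ x
  ... | yes _ = ℓ
  ... | no  _ = c w

  move-at : move x ≡ ℓ
  move-at with x ≟ x
  ... | yes _   = refl
  ... | no  x≢x = ⊥-elim (x≢x refl)

  move-elsewhere : ∀ {w} → w ≢ x → move w ≡ c w
  move-elsewhere {w} w≢x with w ≟ x
  ... | yes w≡x = ⊥-elim (w≢x w≡x)
  ... | no  _   = refl

  move-cases : ∀ w → (w ≡ x × move w ≡ ℓ) ⊎ (w ≢ x × move w ≡ c w)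
  move-cases w = decide (w ≟ x)
    where
    decide : Dec (w ≡ x) → (w ≡ x × move w ≡ ℓ) ⊎ (w ≢ x × move w ≡ c w)
    decide (yes refl) = inj₁ (refl , move-at)
    decide (no  w≢x)  = inj₂ (w≢x , move-elsewhere w≢x)

  move-nonempty : (∀ ℓ′ → ℓ′ ≢ ℓ → ∃ λ w → c w ≡ ℓ′) → ∀ {x′} → x′ ≢ x → c x′ ≡ c x →
                  AllClustersNonempty move
  move-nonempty covered {x′} x′≢x cx′≡cx ℓ′ with ℓ′ ≟ ℓ
  ... | yes ℓ′≡ℓ = x , trans move-at (sym ℓ′≡ℓ)
  ... | no  ℓ′≢ℓ with covered ℓ′ ℓ′≢ℓ
  ...   | w , cw≡ℓ′ with w ≟ x
  ...     | yes refl = x′ , trans (move-elsewhere x′≢x) (trans cx′≡cx cw≡ℓ′)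
  ...     | no  w≢x  = w , trans (move-elsewhere w≢x) cw≡ℓ′

  move-agrees-at : ∀ {w} → w ≢ x → c w ≢ c x → c w ≢ ℓ → SameCluster c x w ⇔ SameCluster move x w
  move-agrees-at w≢x cw≢cx cw≢ℓ =
    mk⇔ (λ e → ⊥-elim (cw≢cx (sym e)))
        (λ e → ⊥-elim (cw≢ℓ (trans (sym (move-elsewhere w≢x)) (trans (sym e) move-at))))

  move-sameAnswers : ∀ {Q : List (Query n)} → (∀ {w} → w ≢ x → c w ≡ c x ⊎ c w ≡ ℓ → ¬ Joins Q x w) →
                     SameAnswers Q c move
  move-sameAnswers {Q} unasked {u , v} q∈ = byCases (u ≟ x) (v ≟ x)
    where
    byCases : Dec (u ≡ x) → Dec (v ≡ x) → SameCluster c u v ⇔ SameCluster move u v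
    byCases (yes refl) (yes refl) = mk⇔ (λ _ → refl) (λ _ → refl)
    byCases (yes refl) (no  v≢x)  =
      move-agrees-at v≢x (λ e → unasked v≢x (inj₁ e) (inj₁ q∈)) (λ e → unasked v≢x (inj₂ e) (inj₁ q∈))
    byCases (no  u≢x)  (yes refl) =
      swap⇔ (move-agrees-at u≢x (λ e → unasked u≢x (inj₁ e) (inj₂ q∈)) (λ e → unasked u≢x (inj₂ e) (inj₂ q∈)))
    byCases (no  u≢x)  (no  v≢x)  =
      mk⇔ (λ e → trans (move-elsewhere u≢x) (trans e (sym (move-elsewhere v≢x))))
          (λ e → trans (sym (move-elsewhere u≢x)) (trans e (move-elsewhere v≢x)))

module _ {n k} {Q : List (Query n)} {c : Labelling n k} (sc : AllClustersNonempty c)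
         {x y : Fin n} (x≢y : x ≢ y) (paired : Paired c x y) (¬xy : ¬ Joins Q x y) where

  private
    cx≡cy = proj₁ paired

  wedge-labelling⇒¬learns : ∀ {z} → x ≢ z → Isolated c z → ¬ Joins Q x z → ¬ Learns n k Q
  wedge-labelling⇒¬learns {z} x≢z isolated ¬xz =
    confusable⇒¬learns sc (move-nonempty c x (c z) (λ ℓ _ → sc ℓ) (x≢y ∘ sym) (sym cx≡cy))
      (move-sameAnswers c x (c z) unasked) cx≡cy separated
    where
    unasked : ∀ {w} → w ≢ x → c w ≡ c x ⊎ c w ≡ c z → ¬ Joins Q x w
    unasked w≢x (inj₁ cw≡cx) with proj₂ paired _ cw≡cx
    ... | inj₁ w≡x  = ⊥-elim (w≢x w≡x)
    ... | inj₂ refl = ¬xy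
    unasked w≢x (inj₂ cw≡cz) rewrite isolated _ cw≡cz = ¬xz
    separated : move c x (c z) x ≢ move c x (c z) y
    separated e = x≢z (isolated x (trans cx≡cy
      (sym (trans (sym (move-at c x (c z))) (trans e (move-elsewhere c x (c z) (x≢y ∘ sym)))))))

  -- {x, y}, {z}, {t} become {x}, {y}, {z, t}: first t joins z, then y takes over the emptied label of t.
  disjoint-labelling⇒¬learns : ∀ {z t} → x ≢ z → x ≢ t → z ≢ t → Isolated c z → Isolated c t →
                               ¬ Joins Q z t → ¬ Learns n k Q
  disjoint-labelling⇒¬learns {z} {t} x≢z x≢t z≢t isoz isot ¬zt =
    confusable⇒¬learns sc (move-nonempty c₁ y (c t) covered x≢y cx₁≡cy₁)
      (sameAnswers-trans (move-sameAnswers c t (c z) unasked₁) (move-sameAnswers c₁ y (c t) unasked₂))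
      cx≡cy separated
    where
    c₁ : Labelling n k
    c₁ = move c t (c z)
    y≢t : y ≢ t
    y≢t y≡t = x≢t (isot x (trans cx≡cy (cong c y≡t)))
    unasked₁ : ∀ {w} → w ≢ t → c w ≡ c t ⊎ c w ≡ c z → ¬ Joins Q t w
    unasked₁ w≢t (inj₁ cw≡ct) = ⊥-elim (w≢t (isot _ cw≡ct))
    unasked₁ w≢t (inj₂ cw≡cz) rewrite isoz _ cw≡cz = ¬zt ∘ joins-sym
    unasked₂ : ∀ {w} → w ≢ y → c₁ w ≡ c₁ y ⊎ c₁ w ≡ c t → ¬ Joins Q y w
    unasked₂ {w} w≢y old∨new with move-cases c t (c z) w | old∨new
    ... | inj₁ (refl , e) | inj₁ e′ =
      λ _ → x≢z (isoz x (trans cx≡cy (sym (trans (sym e) (trans e′ (move-elsewhere c t (c z) y≢t))))))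
    ... | inj₁ (refl , e) | inj₂ e′ = λ _ → z≢t (isot z (trans (sym e) e′))
    ... | inj₂ (w≢t , e)  | inj₂ e′ = λ _ → w≢t (isot w (trans (sym e) e′))
    ... | inj₂ (w≢t , e)  | inj₁ e′
      with proj₂ paired w (trans (sym e) (trans e′ (trans (move-elsewhere c t (c z) y≢t) (sym cx≡cy))))
    ...   | inj₁ refl = ¬xy ∘ joins-sym
    ...   | inj₂ w≡y  = λ _ → w≢y w≡y
    covered : ∀ ℓ → ℓ ≢ c t → ∃ λ w → c₁ w ≡ ℓ
    covered ℓ ℓ≢ct with sc ℓ
    ... | w , cw≡ℓ = w , trans (move-elsewhere c t (c z) (λ w≡t → ℓ≢ct (trans (sym cw≡ℓ) (cong c w≡t)))) cw≡ℓ
    cx₁≡cy₁ : c₁ x ≡ c₁ y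
    cx₁≡cy₁ = trans (move-elsewhere c t (c z) x≢t) (trans cx≡cy (sym (move-elsewhere c t (c z) y≢t)))
    separated : move c₁ y (c t) x ≢ move c₁ y (c t) y
    separated e = x≢t (isot x (trans (sym (move-elsewhere c t (c z) x≢t))
                                     (trans (sym (move-elsewhere c₁ y (c t) x≢y)) (trans e (move-at c₁ y (c t))))))

transpose-at : ∀ {n} (i j : Fin n) → transpose i j ⟨$⟩ʳ i ≡ j
transpose-at i j with i ≟ i
... | yes _   = refl
... | no  i≢i = ⊥-elim (i≢i refl)

transpose-elsewhere : ∀ {n} {i j k : Fin n} → k ≢ i → k ≢ j → transpose i j ⟨$⟩ʳ k ≡ k
transpose-elsewhere {i = i} {j} {k} k≢i k≢j with k ≟ i
... | yes k≡i = ⊥-elim (k≢i k≡i)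
... | no  _ with k ≟ j
...   | yes k≡j = ⊥-elim (k≢j k≡j)
...   | no  _   = refl

Sends : ∀ {n} → Permutation′ n → List (Fin n × Fin n) → Set
Sends π = All (λ p → π ⟨$⟩ʳ proj₁ p ≡ proj₂ p)

permutation-extending : ∀ {n} (ps : List (Fin n × Fin n)) → Unique (map proj₁ ps) → Unique (map proj₂ ps) →
                        ∃ λ π → Sends π ps
permutation-extending []             _          _          = id , []
permutation-extending ((a , b) ∷ ps) (a∉ ∷ uas) (b∉ ∷ ubs)
  with π , sends ← permutation-extending ps uas ubs =
  π ∘ₚ transpose (π ⟨$⟩ʳ a) b ,
  transpose-at (π ⟨$⟩ʳ a) b ∷
  All.tabulate (λ p∈ → keeps (All.lookup (All.map⁻ a∉) p∈) (All.lookup (All.map⁻ b∉) p∈) (All.lookup sends p∈))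
  where
  keeps : ∀ {a′ b′} → a ≢ a′ → b ≢ b′ → π ⟨$⟩ʳ a′ ≡ b′ → transpose (π ⟨$⟩ʳ a) b ⟨$⟩ʳ (π ⟨$⟩ʳ a′) ≡ b′
  keeps a≢a′ b≢b′ refl = transpose-elsewhere
    (λ πa′≡πa → a≢a′ (trans (sym (inverseˡ π)) (trans (cong (π ⟨$⟩ˡ_) (sym πa′≡πa)) (inverseˡ π))))
    (b≢b′ ∘ sym)

module _ {n k} (b : Labelling n k) (π : Permutation′ n) where

  relabel : Labelling n k
  relabel w = b (π ⟨$⟩ʳ w)

  private
    π-injective : ∀ {w w′} → π ⟨$⟩ʳ w ≡ π ⟨$⟩ʳ w′ → w ≡ w′
    π-injective e = trans (sym (inverseˡ π)) (trans (cong (π ⟨$⟩ˡ_) e) (inverseˡ π))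

  relabel-nonempty : AllClustersNonempty b → AllClustersNonempty relabel
  relabel-nonempty nonempty ℓ = π ⟨$⟩ˡ proj₁ (nonempty ℓ) , trans (cong b (inverseʳ π)) (proj₂ (nonempty ℓ))

  relabel-isolated : ∀ {z v} → π ⟨$⟩ʳ z ≡ v → Isolated b v → Isolated relabel z
  relabel-isolated refl isolated w e = π-injective (isolated _ e)

  relabel-paired : ∀ {x y u v} → π ⟨$⟩ʳ x ≡ u → π ⟨$⟩ʳ y ≡ v → Paired b u v → Paired relabel x y
  relabel-paired refl refl (bu≡bv , cluster) = bu≡bv , λ w e → Data.Sum.map π-injective π-injective (cluster _ e)

squeeze : ∀ {m j} → Fin m → Fin (suc j)
squeeze {j = zero}  _       = zero
squeeze {j = suc j} zero    = zero
squeeze {j = suc j} (suc i) = suc (squeeze i)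

squeeze-inject≤ : ∀ {m j} (ℓ : Fin (suc j)) (j<m : j < m) → squeeze (inject≤ ℓ j<m) ≡ ℓ
squeeze-inject≤ {suc _} {zero}  zero    _         = refl
squeeze-inject≤ {suc _} {suc _} zero    _         = refl
squeeze-inject≤ {suc _} {suc _} (suc ℓ) (s≤s j<m) = cong suc (squeeze-inject≤ ℓ j<m)

-- The clusters are {0, 1}, {2}, …, {j}, and all remaining vertices form the last cluster.
collapse : ∀ {m j} → Labelling (suc m) (suc j)
collapse zero    = zero
collapse (suc i) = squeeze i

collapse-nonempty : ∀ {m j} → j < m → AllClustersNonempty (collapse {m} {j})
collapse-nonempty j<m ℓ = suc (inject≤ ℓ j<m) , squeeze-inject≤ ℓ j<m

collapse-paired : ∀ {m j} → Paired (collapse {suc m} {suc j}) 0F 1F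
collapse-paired = refl , λ where
  zero          _  → inj₁ refl
  (suc zero)    _  → inj₂ refl
  (suc (suc _)) ()

collapse-isolated₂ : ∀ {m j} → Isolated (collapse {suc (suc m)} {suc (suc j)}) 2F
collapse-isolated₂ zero                ()
collapse-isolated₂ (suc zero)          ()
collapse-isolated₂ (suc (suc zero))    _  = refl
collapse-isolated₂ (suc (suc (suc _))) ()

collapse-isolated₃ : ∀ {m j} → Isolated (collapse {suc (suc (suc m))} {suc (suc (suc j))}) 3F
collapse-isolated₃ zero                      ()
collapse-isolated₃ (suc zero)                ()
collapse-isolated₃ (suc (suc zero))          ()
collapse-isolated₃ (suc (suc (suc zero)))    _  = refl
collapse-isolated₃ (suc (suc (suc (suc _)))) ()

collapse₄₃-isolated₃ : Isolated (collapse {3} {2}) 3F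
collapse₄₃-isolated₃ zero                   ()
collapse₄₃-isolated₃ (suc zero)             ()
collapse₄₃-isolated₃ (suc (suc zero))       ()
collapse₄₃-isolated₃ (suc (suc (suc zero))) _ = refl

-- Lower bounds for at least three clusters

module _ {m j} {Q : List (Query (suc (suc (suc (suc m)))))}
         (k<n : suc (suc (suc j)) < suc (suc (suc (suc m)))) {x y z} (x≢y : x ≢ y) (x≢z : x ≢ z) (y≢z : y ≢ z)
         (¬xy : ¬ Joins Q x y) where

  private
    base : Labelling (suc (suc (suc (suc m)))) (suc (suc (suc j)))
    base = collapse
    base-nonempty : AllClustersNonempty base
    base-nonempty = collapse-nonempty (ℕ.≤-pred k<n)

  unasked-wedge⇒¬learns : ¬ Joins Q x z → ¬ Learns _ _ Q
  unasked-wedge⇒¬learns ¬xz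
    with π , πx ∷ πy ∷ πz ∷ [] ← permutation-extending ((x , 0F) ∷ (y , 1F) ∷ (z , 2F) ∷ [])
                                   ((x≢y ∷ x≢z ∷ []) ∷ (y≢z ∷ []) ∷ [] ∷ [])
                                   (((λ ()) ∷ (λ ()) ∷ []) ∷ ((λ ()) ∷ []) ∷ [] ∷ []) =
    wedge-labelling⇒¬learns (relabel-nonempty base π base-nonempty) x≢y
      (relabel-paired base π πx πy collapse-paired) ¬xy x≢z (relabel-isolated base π πz collapse-isolated₂) ¬xz

  unasked-disjoint⇒¬learns : ∀ {t} → x ≢ t → y ≢ t → z ≢ t → Isolated base 3F → ¬ Joins Q z t → ¬ Learns _ _ Q
  unasked-disjoint⇒¬learns {t} x≢t y≢t z≢t isolated₃ ¬zt
    with π , πx ∷ πy ∷ πz ∷ πt ∷ [] ← permutation-extending ((x , 0F) ∷ (y , 1F) ∷ (z , 2F) ∷ (t , 3F) ∷ [])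
           ((x≢y ∷ x≢z ∷ x≢t ∷ []) ∷ (y≢z ∷ y≢t ∷ []) ∷ (z≢t ∷ []) ∷ [] ∷ [])
           (((λ ()) ∷ (λ ()) ∷ (λ ()) ∷ []) ∷ ((λ ()) ∷ (λ ()) ∷ []) ∷ ((λ ()) ∷ []) ∷ [] ∷ []) =
    disjoint-labelling⇒¬learns (relabel-nonempty base π base-nonempty) x≢y
      (relabel-paired base π πx πy collapse-paired) ¬xy x≢z x≢t z≢t
      (relabel-isolated base π πz collapse-isolated₂) (relabel-isolated base π πt isolated₃) ¬zt

module _ {m j} {Q : List (Query (suc (suc (suc (suc m)))))} (k<n : suc (suc (suc j)) < suc (suc (suc (suc m))))
         (ordered : All Ordered Q) (learns : Learns _ (suc (suc (suc j))) Q) where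

  learns⇒complement-isMatching : IsMatching (complement Q)
  learns⇒complement-isMatching {b = b} {b′} ab ab′ with b ≟ b′
  ... | yes b≡b′ = b≡b′
  ... | no  b≢b′ = ⊥-elim (unasked-wedge⇒¬learns k<n (joins-ordered⇒≢ (complement-ordered Q) ab)
                             (joins-ordered⇒≢ (complement-ordered Q) ab′) b≢b′ (complement-unasked ordered ab)
                             (complement-unasked ordered ab′) learns)

  learns⇒complement≤1 : Isolated (collapse {suc (suc (suc m))} {suc (suc j)}) 3F → length (complement Q) ≤ 1
  learns⇒complement≤1 isolated₃ = at-most-one (complement-unique Q) equal
    where
    equal : ∀ {p q} → p ∈ complement Q → q ∈ complement Q → p ≡ q
    equal {a , b} {c , d} p∈ q∈ with ≡-dec _≟_ _≟_ (a , b) (c , d)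
    ... | yes p≡q = p≡q
    ... | no  p≢q
      with (a≢c , a≢d) , (b≢c , b≢d) ← matching-disjoint (complement-ordered Q) learns⇒complement-isMatching p∈ q∈ p≢q =
      ⊥-elim (unasked-disjoint⇒¬learns k<n (Fin.<⇒≢ (All.lookup (complement-ordered Q) p∈)) a≢c b≢c
                (complement-unasked ordered (inj₁ p∈)) a≢d b≢d (Fin.<⇒≢ (All.lookup (complement-ordered Q) q∈))
                isolated₃ (complement-unasked ordered (inj₁ q∈)) learns)

-- Lower bound for two clusters

words : ℕ → List (List Bool)
words zero    = [] ∷ []
words (suc r) = map (true ∷_) (words r) ++ map (false ∷_) (words r)

length-words : ∀ r → length (words r) ≡ 2 ^ r
length-words zero    = refl
length-words (suc r) = begin
  length (map (true ∷_) (words r) ++ map (false ∷_) (words r))         ≡⟨ List.length-++ (map (true ∷_) (words r)) ⟩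
  length (map (true ∷_) (words r)) + length (map (false ∷_) (words r)) ≡⟨ cong₂ _+_ (List.length-map _ (words r))
                                                                              (List.length-map _ (words r)) ⟩
  length (words r) + length (words r)                                  ≡⟨ cong₂ _+_ (length-words r)
                                                                              (trans (length-words r) (sym (ℕ.+-identityʳ _))) ⟩
  2 ^ r + (2 ^ r + 0)                                                  ∎
  where open ≡-Reasoning

∈-words : ∀ bs → bs ∈ words (length bs)
∈-words []           = here refl
∈-words (true  ∷ bs) = ∈-++⁺ˡ (∈-map⁺ _ (∈-words bs))
∈-words (false ∷ bs) = ∈-++⁺ʳ (map (true ∷_) (words (length bs))) (∈-map⁺ _ (∈-words bs))

-- Labellings are functions, so they are told apart pointwise rather than by _≡_.
Differ : ∀ {p} → Vector (Fin 2) p → Vector (Fin 2) p → Set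
Differ f g = ∃ λ i → f i ≢ g i

patterns : ∀ p → List (Vector (Fin 2) p)
patterns zero    = (λ ()) ∷ []
patterns (suc p) = map (0F ◂_) (patterns p) ++ map (1F ◂_) (patterns p)

length-patterns : ∀ p → length (patterns p) ≡ 2 ^ p
length-patterns zero    = refl
length-patterns (suc p) = trans (List.length-++ (map (0F ◂_) (patterns p)))
  (cong₂ _+_ (trans (List.length-map _ (patterns p)) (length-patterns p))
             (trans (List.length-map _ (patterns p)) (trans (length-patterns p) (sym (ℕ.+-identityʳ _)))))

patterns-distinct : ∀ p → AllPairs Differ (patterns p)
patterns-distinct zero    = AllPairs._∷_ [] AllPairs.[]
patterns-distinct (suc p) =
  AllPairs.++⁺ (AllPairs.map⁺ (AllPairs.map shift (patterns-distinct p)))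
               (AllPairs.map⁺ (AllPairs.map shift (patterns-distinct p)))
               (All.map⁺ (All.universal (λ _ → All.map⁺ (All.universal (λ _ → zero , λ ()) (patterns p))) (patterns p)))
  where
  shift : ∀ {b} {f g : Vector (Fin 2) p} → Differ f g → Differ (b ◂ f) (b ◂ g)
  shift (i , fi≢gi) = suc i , fi≢gi

answers : ∀ {n k} → List (Query n) → Labelling n k → List Bool
answers Q c = map (λ q → does (c (proj₁ q) ≟ c (proj₂ q))) Q

answers≡⇒sameAnswers : ∀ {n k} {Q : List (Query n)} {c c′ : Labelling n k} →
                       answers Q c ≡ answers Q c′ → SameAnswers Q c c′
answers≡⇒sameAnswers {c = c} {c′} e q∈ = does-≡⇒⇔ (c _ ≟ c _) (c′ _ ≟ c′ _) (map-≡⇒≡ e q∈)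

answers∈words : ∀ {n k} (Q : List (Query n)) (c : Labelling n k) → answers Q c ∈ words (length Q)
answers∈words Q c = subst (λ l → answers Q c ∈ words l) (List.length-map _ Q) (∈-words (answers Q c))

learns₂⇒answers-injective : ∀ {n} {Q : List (Query n)} → Learns n 2 Q → ∀ {c c′ : Labelling n 2} →
  AllClustersNonempty c → AllClustersNonempty c′ → ∀ {v} → c v ≡ c′ v → answers Q c ≡ answers Q c′ →
  ∀ w → c w ≡ c′ w
learns₂⇒answers-injective learns {c} {c′} sc sc′ {v} cv≡c′v e w =
  ≡-determined₂ (λ cv≡cw → trans cv≡c′v (to (partition v w) cv≡cw))
                (λ cv≡c′w → from (partition v w) (trans (sym cv≡c′v) cv≡c′w))
  where
  open Equivalence
  partition = learns c c′ sc sc′ (answers≡⇒sameAnswers {c = c} {c′} e)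

learns₂⇒length : ∀ r (Q : List (Query (suc (suc (suc r))))) → Learns _ 2 Q → suc (suc r) ≤ length Q
learns₂⇒length r Q learns = exponent-< (begin-strict
  2 ^ suc r                                             ≡⟨ length-patterns (suc r) ⟨
  length (patterns (suc r))                             ≡⟨ List.length-map (answers Q ∘ separating) (patterns (suc r)) ⟨
  length (map (answers Q ∘ separating) (patterns (suc r))) <⟨ ℕ.≤-refl ⟩
  length distinct                                       ≤⟨ unique-⊆⇒length≤ distinct-unique distinct⊆words ⟩
  length (words (length Q))                             ≡⟨ length-words (length Q) ⟩
  2 ^ length Q                                          ∎)
  where
  open ℕ.≤-Reasoning
  separating : Vector (Fin 2) (suc r) → Labelling _ 2
  separating f = 0F ◂ 1F ◂ f
  separating-nonempty : ∀ f → AllClustersNonempty (separating f)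
  separating-nonempty f 0F = 0F , refl
  separating-nonempty f 1F = 1F , refl
  joined : Labelling _ 2
  joined = 0F ◂ 0F ◂ λ _ → 1F
  joined-nonempty : AllClustersNonempty joined
  joined-nonempty 0F = 0F , refl
  joined-nonempty 1F = 2F , refl
  distinct : List (List Bool)
  distinct = answers Q joined ∷ map (answers Q ∘ separating) (patterns (suc r))
  distinct-unique : Unique distinct
  distinct-unique =
    All.map⁺ (All.universal (λ f e → 0≢1 (learns₂⇒answers-injective learns {joined} {separating f}
                                            joined-nonempty (separating-nonempty f) {0F} refl e 1F))
                            (patterns (suc r)))
    ∷ AllPairs.map⁺ (AllPairs.map (λ { {f} {g} (i , fi≢gi) e →
        fi≢gi (learns₂⇒answers-injective learns {separating f} {separating g}
                 (separating-nonempty f) (separating-nonempty g) {0F} refl e (suc (suc i))) })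
      (patterns-distinct (suc r)))
    where
    0≢1 : 0F ≢ 1F
    0≢1 ()
  distinct⊆words : distinct ⊆ words (length Q)
  distinct⊆words (here refl) = answers∈words Q joined
  distinct⊆words (there a∈) with f , _ , refl ← ∈-map⁻ _ a∈ = answers∈words Q (separating f)


minQueries-two : (n : ℕ) → 2 < n → MinQueries n 2 (n ∸ 1)
minQueries-two (suc (suc (suc r))) (s≤s (s≤s (s≤s z≤n))) =
  (star _ , (star-ordered _ , star-unique _) , star-learns _ , length-star _) ,
  λ Q _ learns → learns₂⇒length r Q learns

-- The hypothesis on vertex 3 holds exactly when k ≥ 4 or n = 4.
minQueries-all-but-one : ∀ {m j} → suc (suc (suc j)) < suc (suc (suc (suc m))) →
  Isolated (collapse {suc (suc (suc m))} {suc (suc j)}) 3F →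
  MinQueries (suc (suc (suc (suc m)))) (suc (suc (suc j))) (suc (suc (suc (suc m))) C 2 ∸ 1)
minQueries-all-but-one k<n isolated₃ =
  (complement E , (complement-ordered E , complement-unique E) , learns-all-but-one 0F 1F ,
   length-complement E (s≤s z≤n ∷ []) ([] ∷ [])) ,
  λ Q (ordered , _) learns → complement≤⇒length≥ Q (learns⇒complement≤1 k<n ordered learns isolated₃)
  where
  E = (0F , 1F) ∷ []

minQueries-three : (n : ℕ) → 5 ≤ n → MinQueries n 3 (n C 2 ∸ n / 2)
minQueries-three n n≥5@(s≤s (s≤s (s≤s (s≤s (s≤s _))))) =
  (complement (perfectMatching n) ,
   (complement-ordered (perfectMatching n) , complement-unique (perfectMatching n)) ,
   learns-all-but-matching n≥5 perfectMatching-isMatching ,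
   trans (length-complement _ (perfectMatching-ordered n) (perfectMatching-unique n))
         (cong (n C 2 ∸_) (length-perfectMatching n))) ,
  λ Q (ordered , _) learns → complement≤⇒length≥ Q
    (matching-length (complement-ordered Q) (complement-unique Q)
       (learns⇒complement-isMatching (s≤s (s≤s (s≤s (s≤s z≤n)))) ordered learns))

theorem5 : ((n : ℕ) → 2 < n → MinQueries n 2 (n ∸ 1))
    × MinQueries 4 3 5
    × ((n : ℕ) → 5 ≤ n → MinQueries n 3 (n C 2 ∸ n / 2))
    × ((n k : ℕ) → 4 ≤ k → k < n → MinQueries n k (n C 2 ∸ 1))
theorem5 =
  minQueries-two ,
  minQueries-all-but-one (s≤s (s≤s (s≤s (s≤s z≤n)))) collapse₄₃-isolated₃ ,
  minQueries-three ,
  λ { _ _ (s≤s (s≤s (s≤s (s≤s _)))) k<n@(s≤s (s≤s (s≤s (s≤s (s≤s _))))) →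
        minQueries-all-but-one k<n collapse-isolated₃ }
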